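{- Let $m\geq 2$ and $r$ be positive integers, let $I_1=[1,r(m-1)+1]$ and $I_2=[r(m-1)+2,\,2r(m-1)]$, and let $\Delta:I_2\to[1,r]$ be an $L(r)$-coloring (with respect to $m$). Then there exists an $L(r)$-coloring $\Delta_e$ of $I_1\cup I_2$ that extends $\Delta$. Further, $\Delta_e$ satisfies $\Delta_e(1)=\Delta_e(r(m-1)+1)$ and $|\Delta_e^{ -1}(t)\cap[1,r(m-1)]|=m-1$ for every $t\in[1,r]$.
   Context: For integers $a,b$, $[a,b]$ denotes the set of integers $i$ with $a\le i\le b$. An $m$-set $Z=(z_1,\ldots,z_m)$ is a set of $m$ positive integers listed increasingly, $z_1<\cdots<z_m$. For $m$-sets $X,Y$, write $X\prec Y$ if $x_m<y_1$. A set $T$ is monochromatic under a coloring $\Delta$ if $\Delta$ is constant on $T$. Given $m$ and $r$, an $r$-coloring $\Delta:S\to[1,r]$ of a nonempty set $S$ of integers is an $L(r)$-coloring if there do not exist monochromatic $m$-sets $X,Y\subset S$ with $X\prec Y$ and $2(x_m-x_1)\leq y_m-x_1$. -}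

module Defs where

open import Data.Nat using (ℕ; zero; suc; _+_; _*_; _∸_; _≤_; _<_; NonZero)
open import Data.Nat.Properties using ()
open import Data.Fin using (Fin; fromℕ) renaming (zero to fzero; _<_ to _<ᶠ_)
import Data.Fin as Fin
open import Data.List using (List; length; filter; applyUpTo)
open import Data.Product using (Σ; _×_; _,_)
open import Data.Sum using (_⊎_)
open import Data.Empty using (⊥; ⊥-elim)
open import Relation.Nullary using (¬_)
open import Relation.Binary.PropositionalEquality using (_≡_)

[_,_] : ℕ → ℕ → ℕ → Set
[ a , b ] i = a ≤ i × i ≤ b

_∪_ : (ℕ → Set) → (ℕ → Set) → ℕ → Set
(S ∪ T) i = S i ⊎ T i

record MSet (m : ℕ) : Set where
  field
    elt  : Fin m → ℕ
    pos  : ∀ i → 0 < elt i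
    incr : ∀ {i j} → i <ᶠ j → elt i < elt j
open MSet public

firstIx : (m : ℕ) → .{{NonZero m}} → Fin m
firstIx (suc n) = fzero

lastIx : (m : ℕ) → .{{NonZero m}} → Fin m
lastIx (suc n) = fromℕ n

module _ {m : ℕ} .{{_ : NonZero m}} where
  x₁ : MSet m → ℕ
  x₁ X = elt X (firstIx m)

  xₘ : MSet m → ℕ
  xₘ X = elt X (lastIx m)

_⊆ˢ_ : {m : ℕ} → MSet m → (ℕ → Set) → Set
X ⊆ˢ S = ∀ i → S (elt X i)

Monochromatic : {m r : ℕ} → (ℕ → Fin r) → MSet m → Set
Monochromatic Δ X = ∀ i j → Δ (elt X i) ≡ Δ (elt X j)

_≺_ : {m : ℕ} .{{_ : NonZero m}} → MSet m → MSet m → Set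
X ≺ Y = xₘ X < x₁ Y

-- An r-coloring Δ : S → [1,r] (colors represented by Fin r; only the values
-- of Δ on S matter) is an L(r)-coloring (w.r.t. m) if there do not exist
-- monochromatic m-sets X, Y ⊂ S with X ≺ Y and 2(xₘ − x₁) ≤ yₘ − x₁.
LColoring : (m r : ℕ) .{{_ : NonZero m}} → (S : ℕ → Set) → (ℕ → Fin r) → Set
LColoring m r S Δ =
  ¬ (Σ (MSet m) λ X → Σ (MSet m) λ Y →
       X ⊆ˢ S × Y ⊆ˢ S × Monochromatic Δ X × Monochromatic Δ Y ×
       X ≺ Y × 2 * (xₘ X ∸ x₁ X) ≤ xₘ Y ∸ x₁ X)

countColor : {r : ℕ} → (ℕ → Fin r) → Fin r → ℕ → ℕ
countColor Δ t N = length (filter (λ x → Δ x Fin.≟ t) (applyUpTo suc N))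

module Submission where

-- Let n = m − 1 and N = rn.  Some colour c₀ occurs fewer than n times among the N − 1 points of I₂;
-- give N + 1 (and 1) the colour c₀, so that [N + 1, 2N] reads c₀ followed by I₂.  Colour [1, N] by
-- shifting this sequence down by N, replacing every occurrence beyond the n-th of a colour by a colour
-- still short of n occurrences.  Then every colour occurs exactly n times on [1, N], and each window
-- [1, j + 1] contains, capped at n, at least as many points of each colour as [N + 1, N + 1 + j].
-- Now let X ≺ Y be monochromatic of colour t with 2(xₘ − x₁) ≤ yₘ − x₁ ≤ 2N − x₁.  If x₁ ≥ N + 2 both
-- sets lie in I₂; if x₁ = N + 1 then t = c₀ occurs m > n times in [N + 1, 2N].  If x₁ ≤ N, the points
-- of X above N lie in a window [N + 1, N + 1 + j] with j + 1 < x₁, so their shadow in [1, j + 1] lies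
-- left of X and, together with the points of X in [x₁, N], gives more than n points of colour t in [1, N].

open import Defs
open import Data.Nat using (ℕ; zero; suc; _+_; _*_; _∸_; _≤_; _<_; _⊓_; z≤n; s≤s; _≤?_; _<?_; NonZero)
open import Data.Nat.Properties
open import Data.Nat.Tactic.RingSolver using (solve-∀)
open import Algebra.Properties.CommutativeMonoid.Sum +-0-commutativeMonoid
  using (sum; sum-cong-≗; ∑-distrib-+)
open import Algebra.Properties.CommutativeSemigroup +-commutativeSemigroup using (xy∙z≈xz∙y)
open import Data.Bool using (Bool; true; false)
open import Data.Fin using (Fin)
import Data.Fin as Fin
open import Data.List using (List; []; _∷_; _++_; replicate; map; length; filter; applyUpTo)
open import Data.List.Properties using (length-++; length-replicate; length-map; filter-++; applyUpTo-∷ʳ)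
open import Data.Maybe using (Maybe; just; nothing; fromMaybe; is-nothing)
open import Data.Product using (Σ; ∃; _×_; _,_; proj₁; proj₂)
open import Data.Sum using (_⊎_; inj₁; inj₂; [_,_]′)
open import Data.Empty using (⊥)
open import Function using (_∘_)
open import Relation.Nullary using (¬_; yes; no; does; contradiction)
open import Relation.Nullary.Decidable using (dec-true; dec-false)
open import Relation.Unary using (Pred; Decidable)
open import Relation.Binary using (Tri; tri<; tri≈; tri>)
open import Relation.Binary.PropositionalEquality
  using (_≡_; refl; sym; trans; cong; cong₂; subst; subst₂; module ≡-Reasoning)

indicator : Bool → ℕ
indicator false = 0
indicator true  = 1

count : (ℕ → Bool) → ℕ → ℕ
count p zero    = 0
count p (suc k) = count p k + indicator (p k)

module _ (p : ℕ → Bool) where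

  count-true : ∀ {k} → p k ≡ true → count p (suc k) ≡ suc (count p k)
  count-true {k} pk≡true rewrite pk≡true = +-comm (count p k) 1

  count-mono : ∀ {a b} → a ≤ b → count p a ≤ count p b
  count-mono {b = zero} z≤n = ≤-refl
  count-mono {a} {suc b} a≤1+b with m≤n⇒m<n∨m≡n a≤1+b
  ... | inj₁ a<1+b = ≤-trans (count-mono (≤-pred a<1+b)) (m≤m+n _ _)
  ... | inj₂ refl  = ≤-refl

  count-+ : ∀ a j → count p a + count (λ i → p (a + i)) j ≡ count p (a + j)
  count-+ a zero = trans (+-identityʳ _) (cong (count p) (sym (+-identityʳ a)))
  count-+ a (suc j) = begin
    count p a + (count (λ i → p (a + i)) j + indicator (p (a + j)))
      ≡⟨ sym (+-assoc (count p a) _ _) ⟩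
    count p a + count (λ i → p (a + i)) j + indicator (p (a + j))
      ≡⟨ cong (_+ indicator (p (a + j))) (count-+ a j) ⟩
    count p (suc (a + j))
      ≡⟨ cong (count p) (sym (+-suc a j)) ⟩
    count p (a + suc j) ∎
    where open ≡-Reasoning

  count-increasing : ∀ (g : ℕ → ℕ) k lo hi → lo ≤ hi →
    (∀ j → j < k → p (g j) ≡ true × lo ≤ g j × g j < hi) →
    (∀ i j → i < j → j < k → g i < g j) →
    count p lo + k ≤ count p hi
  count-increasing g zero lo hi lo≤hi _ _ = ≤-trans (≤-reflexive (+-identityʳ _)) (count-mono lo≤hi)
  count-increasing g (suc k) lo hi lo≤hi pts incr = begin
    count p lo + suc k     ≡⟨ +-suc (count p lo) k ⟩
    suc (count p lo + k)   ≤⟨ s≤s below-last ⟩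
    suc (count p (g k))    ≡⟨ sym (count-true p-last) ⟩
    count p (suc (g k))    ≤⟨ count-mono last<hi ⟩
    count p hi             ∎
    where
    open ≤-Reasoning
    p-last : p (g k) ≡ true
    p-last = proj₁ (pts k ≤-refl)
    last<hi : g k < hi
    last<hi = proj₂ (proj₂ (pts k ≤-refl))
    below-last : count p lo + k ≤ count p (g k)
    below-last = count-increasing g k lo (g k) (proj₁ (proj₂ (pts k ≤-refl)))
      (λ j j<k → let (pj , lo≤ , _) = pts j (m<n⇒m<1+n j<k) in pj , lo≤ , incr j k j<k ≤-refl)
      (λ i j i<j j<k → incr i j i<j (m<n⇒m<1+n j<k))

count-cong : ∀ {p q} k → (∀ i → i < k → p i ≡ q i) → count p k ≡ count q k
count-cong zero    p≗q = refl
count-cong (suc k) p≗q =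
  cong₂ _+_ (count-cong k (λ i i<k → p≗q i (m<n⇒m<1+n i<k))) (cong indicator (p≗q k ≤-refl))

module _ {a p} {A : Set a} {P : Pred A p} (P? : Decidable P) where

  length-filter-applyUpTo : ∀ (f : ℕ → A) k →
    length (filter P? (applyUpTo f k)) ≡ count (λ i → does (P? (f i))) k
  length-filter-applyUpTo f zero = refl
  length-filter-applyUpTo f (suc k) = begin
    length (filter P? (applyUpTo f (suc k)))
      ≡⟨ cong (length ∘ filter P?) (sym (applyUpTo-∷ʳ f k)) ⟩
    length (filter P? (applyUpTo f k ++ (f k ∷ [])))
      ≡⟨ cong length (filter-++ P? (applyUpTo f k) (f k ∷ [])) ⟩
    length (filter P? (applyUpTo f k) ++ filter P? (f k ∷ []))
      ≡⟨ length-++ (filter P? (applyUpTo f k)) ⟩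
    length (filter P? (applyUpTo f k)) + length (filter P? (f k ∷ []))
      ≡⟨ cong₂ _+_ (length-filter-applyUpTo f k) (length-filter-singleton (f k)) ⟩
    count (λ i → does (P? (f i))) (suc k) ∎
    where
    open ≡-Reasoning
    length-filter-singleton : ∀ x → length (filter P? (x ∷ [])) ≡ indicator (does (P? x))
    length-filter-singleton x with does (P? x)
    ... | false = refl
    ... | true  = refl

_==_ : ∀ {r} → Fin r → Fin r → Bool
s == t = does (s Fin.≟ t)

==-refl : ∀ {r} (t : Fin r) → t == t ≡ true
==-refl t = dec-true (t Fin.≟ t) refl

occ : ∀ {r} → (ℕ → Fin r) → Fin r → ℕ → ℕ
occ c t = count (λ x → c x == t)

sum-const : ∀ r c → sum {r} (λ _ → c) ≡ r * c
sum-const zero    c = refl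
sum-const (suc r) c = cong (c +_) (sum-const r c)

sum-indicator-== : ∀ {r} (u : Fin r) → sum (λ t → indicator (u == t)) ≡ 1
sum-indicator-== {suc r} Fin.zero    = cong suc (trans (sum-const r 0) (*-zeroʳ r))
sum-indicator-== {suc r} (Fin.suc u) = sum-indicator-== u

sum-count : ∀ {r} (p : Fin r → ℕ → Bool) → (∀ i → sum (λ t → indicator (p t i)) ≡ 1) →
  ∀ k → sum (λ t → count (p t) k) ≡ k
sum-count {r} p once zero = trans (sum-const r 0) (*-zeroʳ r)
sum-count {r} p once (suc k) = begin
  sum (λ t → count (p t) k + indicator (p t k))
    ≡⟨ ∑-distrib-+ (λ t → count (p t) k) (λ t → indicator (p t k)) ⟩
  sum (λ t → count (p t) k) + sum (λ t → indicator (p t k))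
    ≡⟨ cong₂ _+_ (sum-count p once k) (once k) ⟩
  k + 1
    ≡⟨ +-comm k 1 ⟩
  suc k ∎
  where open ≡-Reasoning

sum-occ : ∀ {r} (c : ℕ → Fin r) k → sum (λ t → occ c t k) ≡ k
sum-occ c = sum-count (λ t x → c x == t) (λ x → sum-indicator-== (c x))

sum<⇒∃< : ∀ {r} (f : Fin r → ℕ) n → sum f < r * n → ∃ λ t → f t < n
sum<⇒∃< {suc r} f n sumf< with f Fin.zero <? n
... | yes f0<n = Fin.zero , f0<n
... | no  f0≮n =
  let (t , ft<n) = sum<⇒∃< (f ∘ Fin.suc) n
                     (+-cancelˡ-< n _ _ (≤-<-trans (+-monoˡ-≤ _ (≮⇒≥ f0≮n)) sumf<))
  in Fin.suc t , ft<n

occurrences : ∀ {r} → Fin r → List (Fin r) → ℕ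
occurrences t []       = 0
occurrences t (x ∷ xs) = indicator (x == t) + occurrences t xs

occurrences-++ : ∀ {r} (t : Fin r) xs ys →
  occurrences t (xs ++ ys) ≡ occurrences t xs + occurrences t ys
occurrences-++ t []       ys = refl
occurrences-++ t (x ∷ xs) ys =
  trans (cong (indicator (x == t) +_) (occurrences-++ t xs ys)) (sym (+-assoc (indicator (x == t)) _ _))

repeatEach : ∀ {r} → (Fin r → ℕ) → List (Fin r)
repeatEach {zero}  c = []
repeatEach {suc r} c = replicate (c Fin.zero) Fin.zero ++ map Fin.suc (repeatEach (c ∘ Fin.suc))

length-repeatEach : ∀ {r} (c : Fin r → ℕ) → length (repeatEach c) ≡ sum c
length-repeatEach {zero}  c = refl
length-repeatEach {suc r} c = begin
  length (replicate (c Fin.zero) Fin.zero ++ map Fin.suc (repeatEach (c ∘ Fin.suc)))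
    ≡⟨ length-++ (replicate (c Fin.zero) Fin.zero) ⟩
  length (replicate (c Fin.zero) Fin.zero) + length (map Fin.suc (repeatEach (c ∘ Fin.suc)))
    ≡⟨ cong₂ _+_ (length-replicate (c Fin.zero)) (length-map Fin.suc (repeatEach (c ∘ Fin.suc))) ⟩
  c Fin.zero + length (repeatEach (c ∘ Fin.suc))
    ≡⟨ cong (c Fin.zero +_) (length-repeatEach (c ∘ Fin.suc)) ⟩
  sum c ∎
  where open ≡-Reasoning

occurrences-repeatEach : ∀ {r} (c : Fin r → ℕ) t → occurrences t (repeatEach c) ≡ c t
occurrences-repeatEach {suc r} c t = begin
  occurrences t (replicate (c Fin.zero) Fin.zero ++ map Fin.suc (repeatEach (c ∘ Fin.suc)))
    ≡⟨ occurrences-++ t (replicate (c Fin.zero) Fin.zero) _ ⟩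
  occurrences t (replicate (c Fin.zero) Fin.zero) + occurrences t (map Fin.suc (repeatEach (c ∘ Fin.suc)))
    ≡⟨ split t ⟩
  c t ∎
  where
  open ≡-Reasoning
  zeros : ∀ k → occurrences Fin.zero (replicate k (Fin.zero {r})) ≡ k
  zeros zero    = refl
  zeros (suc k) = cong suc (zeros k)
  no-zeros : ∀ t k → occurrences (Fin.suc t) (replicate k (Fin.zero {r})) ≡ 0
  no-zeros t zero    = refl
  no-zeros t (suc k) = no-zeros t k
  shifted-zero : ∀ xs → occurrences Fin.zero (map (Fin.suc {r}) xs) ≡ 0
  shifted-zero []       = refl
  shifted-zero (x ∷ xs) = shifted-zero xs
  shifted-suc : ∀ t xs → occurrences (Fin.suc t) (map (Fin.suc {r}) xs) ≡ occurrences t xs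
  shifted-suc t []       = refl
  shifted-suc t (x ∷ xs) = cong (indicator (x == t) +_) (shifted-suc t xs)
  split : ∀ t → occurrences t (replicate (c Fin.zero) Fin.zero)
                  + occurrences t (map Fin.suc (repeatEach (c ∘ Fin.suc))) ≡ c t
  split Fin.zero    = trans (cong₂ _+_ (zeros (c Fin.zero)) (shifted-zero (repeatEach (c ∘ Fin.suc)))) (+-identityʳ _)
  split (Fin.suc t) = trans (cong₂ _+_ (no-zeros t (c Fin.zero)) (shifted-suc t (repeatEach (c ∘ Fin.suc))))
                            (occurrences-repeatEach (c ∘ Fin.suc) t)

lookupOr : ∀ {a} {A : Set a} → List A → A → ℕ → A
lookupOr []       d i       = d
lookupOr (x ∷ xs) d zero    = x
lookupOr (x ∷ xs) d (suc i) = lookupOr xs d i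

occ-lookupOr : ∀ {r} (xs : List (Fin r)) d t → occ (lookupOr xs d) t (length xs) ≡ occurrences t xs
occ-lookupOr []       d t = refl
occ-lookupOr (x ∷ xs) d t = trans (sym (count-+ (λ i → lookupOr (x ∷ xs) d i == t) 1 (length xs)))
                                  (cong (indicator (x == t) +_) (occ-lookupOr xs d t))

⊓-+1-below : ∀ {a n} → a + 1 ≤ n → a ⊓ n + 1 ≡ (a + 1) ⊓ n
⊓-+1-below {a} {n} a+1≤n = begin
  a ⊓ n + 1    ≡⟨ cong (_+ 1) (m≤n⇒m⊓n≡m (≤-trans (m≤m+n a 1) a+1≤n)) ⟩
  a + 1        ≡⟨ sym (m≤n⇒m⊓n≡m a+1≤n) ⟩
  (a + 1) ⊓ n  ∎
  where open ≡-Reasoning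

⊓-+1-above : ∀ {a n} → ¬ (a + 1 ≤ n) → a ⊓ n ≡ (a + 1) ⊓ n
⊓-+1-above {a} {n} a+1≰n = trans (m≥n⇒m⊓n≡n n≤a) (sym (m≥n⇒m⊓n≡n (≤-trans n≤a (m≤m+n a 1))))
  where
  n≤a : n ≤ a
  n≤a = ≤-pred (subst (n <_) (+-comm a 1) (≰⇒> a+1≰n))

module Balance {r : ℕ} (n : ℕ) (v : ℕ → Fin r) where

  L : ℕ
  L = r * n

  kept : ℕ → Maybe (Fin r)
  kept i with occ v (v i) (suc i) ≤? n
  ... | yes _ = just (v i)
  ... | no  _ = nothing

  is : Fin r → Maybe (Fin r) → Bool
  is t (just u) = u == t
  is t nothing  = false

  holes : ℕ → ℕ
  holes = count (is-nothing ∘ kept)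

  copies : Fin r → ℕ → ℕ
  copies t = count (is t ∘ kept)

  copies≡occ⊓n : ∀ t k → copies t k ≡ occ v t k ⊓ n
  copies≡occ⊓n t zero = refl
  copies≡occ⊓n t (suc k) with v k Fin.≟ t
  ... | no vk≢t = begin
    copies t k + indicator (is t (kept k))  ≡⟨ cong (λ b → copies t k + indicator b) not-copied ⟩
    copies t k + 0                          ≡⟨ +-identityʳ _ ⟩
    copies t k                              ≡⟨ copies≡occ⊓n t k ⟩
    occ v t k ⊓ n                           ≡⟨ cong (_⊓ n) (sym (+-identityʳ _)) ⟩
    (occ v t k + 0) ⊓ n                     ∎
    where
    open ≡-Reasoning
    not-copied : is t (kept k) ≡ false
    not-copied with occ v (v k) (suc k) ≤? n
    ... | yes _ = dec-false (v k Fin.≟ t) vk≢t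
    ... | no  _ = refl
  ... | yes refl with occ v (v k) (suc k) ≤? n
  ...   | yes bound = begin
    copies (v k) k + indicator (v k == v k)  ≡⟨ cong (λ b → copies (v k) k + indicator b) (==-refl (v k)) ⟩
    copies (v k) k + 1                       ≡⟨ cong (_+ 1) (copies≡occ⊓n (v k) k) ⟩
    occ v (v k) k ⊓ n + 1                    ≡⟨ ⊓-+1-below (subst (λ b → occ v (v k) k + indicator b ≤ n)
                                                                 (==-refl (v k)) bound) ⟩
    (occ v (v k) k + 1) ⊓ n                  ∎
    where open ≡-Reasoning
  ...   | no excess = begin
    copies (v k) k + 0                      ≡⟨ +-identityʳ _ ⟩
    copies (v k) k                          ≡⟨ copies≡occ⊓n (v k) k ⟩
    occ v (v k) k ⊓ n                       ≡⟨ ⊓-+1-above (subst (λ b → ¬ (occ v (v k) k + indicator b ≤ n))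
                                                               (==-refl (v k)) excess) ⟩
    (occ v (v k) k + 1) ⊓ n                  ∎
    where open ≡-Reasoning

  holes+copies : ∀ k → holes k + sum (λ t → copies t k) ≡ k
  holes+copies = sum-count slot slot-unique
    where
    slot : Fin (suc r) → ℕ → Bool
    slot Fin.zero    = is-nothing ∘ kept
    slot (Fin.suc t) = is t ∘ kept
    slot-unique : ∀ i → sum (λ t → indicator (slot t i)) ≡ 1
    slot-unique i with kept i
    ... | nothing = cong suc (trans (sum-const r 0) (*-zeroʳ r))
    ... | just u  = sum-indicator-== u

  deficit : Fin r → ℕ
  deficit t = n ∸ occ v t L

  fillers : List (Fin r)
  fillers = repeatEach deficit

  -- the default v 0 is never read, by holes-total below
  fill : ℕ → Fin r
  fill = lookupOr fillers (v 0)

  balance : ℕ → Fin r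
  balance i = fromMaybe (fill (holes i)) (kept i)

  occ-balance : ∀ t k → occ balance t k ≡ copies t k + occ fill t (holes k)
  occ-balance t zero = refl
  occ-balance t (suc k) with kept k
  ... | just u = begin
    occ balance t k + indicator (u == t)
      ≡⟨ cong (_+ indicator (u == t)) (occ-balance t k) ⟩
    copies t k + occ fill t (holes k) + indicator (u == t)
      ≡⟨ xy∙z≈xz∙y (copies t k) _ _ ⟩
    copies t k + indicator (u == t) + occ fill t (holes k)
      ≡⟨ cong (λ h → copies t k + indicator (u == t) + occ fill t h) (sym (+-identityʳ (holes k))) ⟩
    copies t k + indicator (u == t) + occ fill t (holes k + 0) ∎
    where open ≡-Reasoning
  ... | nothing = begin
    occ balance t k + indicator (fill (holes k) == t)
      ≡⟨ cong (_+ indicator (fill (holes k) == t)) (occ-balance t k) ⟩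
    copies t k + occ fill t (holes k) + indicator (fill (holes k) == t)
      ≡⟨ +-assoc (copies t k) _ _ ⟩
    copies t k + occ fill t (suc (holes k))
      ≡⟨ cong₂ _+_ (sym (+-identityʳ _)) (cong (occ fill t) (+-comm 1 (holes k))) ⟩
    copies t k + 0 + occ fill t (holes k + 1) ∎
    where open ≡-Reasoning

  holes-total : holes L ≡ length fillers
  holes-total = +-cancelʳ-≡ (sum capped) (holes L) (length fillers) (begin
    holes L + sum capped
      ≡⟨ cong (holes L +_) (sum-cong-≗ (λ t → sym (copies≡occ⊓n t L))) ⟩
    holes L + sum (λ t → copies t L)
      ≡⟨ holes+copies L ⟩
    r * n
      ≡⟨ sym (sum-const r n) ⟩
    sum {r} (λ _ → n)
      ≡⟨ sum-cong-≗ {r} {λ _ → n} (λ t → sym (trans (+-comm (deficit t) (capped t)) (m⊓n+n∸m≡n (occ v t L) n))) ⟩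
    sum (λ t → deficit t + capped t)
      ≡⟨ ∑-distrib-+ deficit capped ⟩
    sum deficit + sum capped
      ≡⟨ cong (_+ sum capped) (sym (length-repeatEach deficit)) ⟩
    length fillers + sum capped ∎)
    where
    open ≡-Reasoning
    capped : Fin r → ℕ
    capped t = occ v t L ⊓ n

  balance-balanced : ∀ t → occ balance t L ≡ n
  balance-balanced t = begin
    occ balance t L                             ≡⟨ occ-balance t L ⟩
    copies t L + occ fill t (holes L)           ≡⟨ cong₂ _+_ (copies≡occ⊓n t L) (cong (occ fill t) holes-total) ⟩
    occ v t L ⊓ n + occ fill t (length fillers) ≡⟨ cong (occ v t L ⊓ n +_) (occ-lookupOr fillers (v 0) t) ⟩
    occ v t L ⊓ n + occurrences t fillers       ≡⟨ cong (occ v t L ⊓ n +_) (occurrences-repeatEach deficit t) ⟩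
    occ v t L ⊓ n + deficit t                   ≡⟨ m⊓n+n∸m≡n (occ v t L) n ⟩
    n                                           ∎
    where open ≡-Reasoning

  balance-dominates : ∀ t k → occ v t k ⊓ n ≤ occ balance t k
  balance-dominates t k = begin
    occ v t k ⊓ n                      ≡⟨ sym (copies≡occ⊓n t k) ⟩
    copies t k                         ≤⟨ m≤m+n (copies t k) _ ⟩
    copies t k + occ fill t (holes k)  ≡⟨ sym (occ-balance t k) ⟩
    occ balance t k                    ∎
    where open ≤-Reasoning

  balance-head : 1 ≤ n → balance 0 ≡ v 0
  balance-head 1≤n with occ v (v 0) 1 ≤? n
  ... | yes _   = refl
  ... | no  1≰n = contradiction (subst (λ b → indicator b ≤ n) (sym (==-refl (v 0))) 1≤n) 1≰n

clamp : ∀ n → ℕ → Fin (suc n)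
clamp zero    j       = Fin.zero
clamp (suc n) zero    = Fin.zero
clamp (suc n) (suc j) = Fin.suc (clamp n j)

toℕ-clamp : ∀ n {j} → j ≤ n → Fin.toℕ (clamp n j) ≡ j
toℕ-clamp zero    z≤n       = refl
toℕ-clamp (suc n) z≤n       = refl
toℕ-clamp (suc n) (s≤s j≤n) = cong suc (toℕ-clamp n j≤n)

clamp-zero : ∀ n → clamp n 0 ≡ Fin.zero
clamp-zero zero    = refl
clamp-zero (suc n) = refl

clamp-last : ∀ n → clamp n n ≡ Fin.fromℕ n
clamp-last zero    = refl
clamp-last (suc n) = cong Fin.suc (clamp-last n)

module _ {n : ℕ} (X : MSet (suc n)) where

  -- indices past n all name the last point
  point : ℕ → ℕ
  point j = elt X (clamp n j)

  point-first : point 0 ≡ x₁ X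
  point-first = cong (elt X) (clamp-zero n)

  point-last : point n ≡ xₘ X
  point-last = cong (elt X) (clamp-last n)

  point-< : ∀ {i j} → i < j → j ≤ n → point i < point j
  point-< {i} {j} i<j j≤n = incr X (subst₂ _<_ (sym (toℕ-clamp n (≤-trans (<⇒≤ i<j) j≤n)))
                                               (sym (toℕ-clamp n j≤n)) i<j)

  point-≤ : ∀ {i j} → i ≤ j → j ≤ n → point i ≤ point j
  point-≤ i≤j j≤n with m≤n⇒m<n∨m≡n i≤j
  ... | inj₁ i<j  = <⇒≤ (point-< i<j j≤n)
  ... | inj₂ refl = ≤-refl

  x₁≤point : ∀ j → j ≤ n → x₁ X ≤ point j
  x₁≤point j j≤n = subst (_≤ point j) point-first (point-≤ z≤n j≤n)

  point≤xₘ : ∀ j → j ≤ n → point j ≤ xₘ X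
  point≤xₘ j j≤n = subst (point j ≤_) point-last (point-≤ j≤n ≤-refl)

  x₁<xₘ : 1 ≤ n → x₁ X < xₘ X
  x₁<xₘ 1≤n = subst₂ _<_ point-first point-last (point-< 1≤n ≤-refl)

  x₁≤elt : ∀ i → x₁ X ≤ elt X i
  x₁≤elt Fin.zero    = ≤-refl
  x₁≤elt (Fin.suc i) = <⇒≤ (incr X {Fin.zero} {Fin.suc i} (s≤s z≤n))

occ-points : ∀ {n r} (c : ℕ → Fin r) (X : MSet (suc n)) → Monochromatic c X →
  ∀ i₀ k lo hi → lo ≤ hi → i₀ + k ≤ suc n →
  (∀ j → i₀ ≤ j → j < i₀ + k → lo ≤ point X j × point X j < hi) →
  occ c (c (x₁ X)) lo + k ≤ occ c (c (x₁ X)) hi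
occ-points {n} c X mono i₀ k lo hi lo≤hi range bounds =
  count-increasing (λ x → c x == c (x₁ X)) (λ j → point X (i₀ + j)) k lo hi lo≤hi
    (λ j j<k → trans (cong (_== c (x₁ X)) (mono (clamp n (i₀ + j)) Fin.zero)) (==-refl (c (x₁ X))) ,
               bounds (i₀ + j) (m≤m+n i₀ j) (+-monoʳ-< i₀ j<k))
    (λ i j i<j j<k → point-< X (+-monoʳ-< i₀ i<j) (≤-pred (≤-trans (+-monoʳ-< i₀ j<k) range)))

threshold : ∀ (g : ℕ → ℕ) N n →
  (∀ j → j ≤ n → g j ≤ N) ⊎ ∃ λ k → k ≤ n × (∀ j → j < k → g j ≤ N) × N < g k
threshold g N zero with g 0 ≤? N
... | yes g0≤N = inj₁ λ { zero _ → g0≤N }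
... | no  g0≰N = inj₂ (0 , z≤n , (λ j ()) , ≰⇒> g0≰N)
threshold g N (suc n) with threshold g N n
... | inj₂ (k , k≤n , below , exceeds) = inj₂ (k , m≤n⇒m≤1+n k≤n , below , exceeds)
... | inj₁ all≤N with g (suc n) ≤? N
...   | no  g≰N = inj₂ (suc n , ≤-refl , (λ j j<1+n → all≤N j (≤-pred j<1+n)) , ≰⇒> g≰N)
...   | yes g≤N = inj₁ λ j j≤1+n → [ (λ j<1+n → all≤N j (≤-pred j<1+n))
                                   , (λ j≡1+n → subst (λ i → g i ≤ N) (sym j≡1+n) g≤N)
                                   ]′ (m≤n⇒m<n∨m≡n j≤1+n)

double-gap : ∀ {a b c} → a < b → 2 * (b ∸ a) ≤ c ∸ a → b + b ≤ c + a
double-gap {a} {b} {c} a<b gap = begin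
  b + b                  ≡⟨ cong₂ _+_ (sym d+a≡b) (sym d+a≡b) ⟩
  (d + a) + (d + a)      ≡⟨ rearrange d a ⟩
  2 * d + a + a          ≤⟨ +-monoˡ-≤ a (+-monoˡ-≤ a gap) ⟩
  (c ∸ a) + a + a        ≡⟨ cong (_+ a) (m∸n+n≡m (<⇒≤ a<c)) ⟩
  c + a                  ∎
  where
  open ≤-Reasoning
  d : ℕ
  d = b ∸ a
  d+a≡b : d + a ≡ b
  d+a≡b = m∸n+n≡m (<⇒≤ a<b)
  rearrange : ∀ d a → (d + a) + (d + a) ≡ 2 * d + a + a
  rearrange = solve-∀
  a<c : a < c
  a<c = m∸n≢0⇒n<m λ c∸a≡0 →
    contradiction (subst (2 * d ≤_) c∸a≡0 gap) (<⇒≱ (≤-trans (m<n⇒0<n∸m a<b) (m≤m+n d (d + 0))))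

window-before-start : ∀ N j a → (suc N + j) + (suc N + j) ≤ N + N + a → suc (suc j) ≤ a
window-before-start N j a spread = ≤-trans (s≤s (s≤s (m≤m+n j j))) (+-cancelˡ-≤ (N + N) _ _ (begin
  N + N + suc (suc (j + j))    ≡⟨ rearrange N j ⟩
  (suc N + j) + (suc N + j)    ≤⟨ spread ⟩
  N + N + a                    ∎))
  where
  open ≤-Reasoning
  rearrange : ∀ N j → N + N + suc (suc (j + j)) ≡ (suc N + j) + (suc N + j)
  rearrange = solve-∀

module Extension {r n : ℕ} (1≤r : 1 ≤ r) (1≤n : 1 ≤ n) (Δ : ℕ → Fin r) where

  N : ℕ
  N = r * n

  1≤N : 1 ≤ N
  1≤N = *-mono-≤ 1≤r 1≤n

  N+2≡2+N : N + 2 ≡ suc (suc N)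
  N+2≡2+N = +-comm N 2

  I₂ : ℕ → Set
  I₂ = [ N + 2 , 2 * r * n ]

  S : ℕ → Set
  S = [ 1 , N + 1 ] ∪ I₂

  secondBlock : ℕ → Fin r
  secondBlock i = Δ (suc (suc (N + i)))

  1+[N∸1]≡N : suc (N ∸ 1) ≡ N
  1+[N∸1]≡N = m+[n∸m]≡n 1≤N

  -- pigeonhole: the N ∸ 1 points of [N + 2, 2N] cannot carry every colour n times
  scarce : ∃ λ t → occ secondBlock t (N ∸ 1) < n
  scarce = sum<⇒∃< (λ t → occ secondBlock t (N ∸ 1)) n
             (subst₂ _<_ (sym (sum-occ secondBlock (N ∸ 1))) 1+[N∸1]≡N ≤-refl)

  c₀ : Fin r
  c₀ = proj₁ scarce

  fromMiddle : ℕ → Fin r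
  fromMiddle zero    = c₀
  fromMiddle (suc i) = secondBlock i

  open Balance n fromMiddle using (balance; balance-balanced; balance-dominates; balance-head)

  Δₑ : ℕ → Fin r
  Δₑ zero = Δ zero
  Δₑ (suc i) with <-cmp i N
  ... | tri< _ _ _ = balance i
  ... | tri≈ _ _ _ = c₀
  ... | tri> _ _ _ = Δ (suc i)

  Δₑ-first : ∀ {i} → i < N → Δₑ (suc i) ≡ balance i
  Δₑ-first {i} i<N with <-cmp i N
  ... | tri< _ _   _ = refl
  ... | tri≈ i≮N _ _ = contradiction i<N i≮N
  ... | tri> i≮N _ _ = contradiction i<N i≮N

  Δₑ-middle : Δₑ (suc N) ≡ c₀
  Δₑ-middle with <-cmp N N
  ... | tri< _ N≢N _ = contradiction refl N≢N
  ... | tri≈ _ _   _ = refl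
  ... | tri> _ N≢N _ = contradiction refl N≢N

  Δₑ-second-block : ∀ {x} → suc (suc N) ≤ x → Δₑ x ≡ Δ x
  Δₑ-second-block {suc i} (s≤s N<i) with <-cmp i N
  ... | tri< _ _ i≯N = contradiction N<i i≯N
  ... | tri≈ _ _ i≯N = contradiction N<i i≯N
  ... | tri> _ _ _   = refl

  Δₑ-from-middle : ∀ i → Δₑ (suc N + i) ≡ fromMiddle i
  Δₑ-from-middle zero    = trans (cong (Δₑ ∘ suc) (+-identityʳ N)) Δₑ-middle
  Δₑ-from-middle (suc i) =
    trans (Δₑ-second-block (s≤s (subst (suc N ≤_) (sym (+-suc N i)) (s≤s (m≤m+n N i)))))
          (cong (Δ ∘ suc) (+-suc N i))

  occ-first : ∀ t k → k ≤ N → occ Δₑ t 1 + occ balance t k ≡ occ Δₑ t (suc k)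
  occ-first t k k≤N =
    trans (cong (occ Δₑ t 1 +_) (count-cong k λ i i<k → cong (_== t) (sym (Δₑ-first (≤-trans i<k k≤N)))))
          (count-+ (λ x → Δₑ x == t) 1 k)

  occ-from-middle : ∀ t k → occ Δₑ t (suc N) + occ fromMiddle t k ≡ occ Δₑ t (suc N + k)
  occ-from-middle t k =
    trans (cong (occ Δₑ t (suc N) +_) (count-cong k λ i _ → cong (_== t) (sym (Δₑ-from-middle i))))
          (count-+ (λ x → Δₑ x == t) (suc N) k)

  first-block-balanced : ∀ t → occ Δₑ t (suc N) ≡ occ Δₑ t 1 + n
  first-block-balanced t = trans (sym (occ-first t N ≤-refl)) (cong (occ Δₑ t 1 +_) (balance-balanced t))

  c₀-scarce-from-middle : occ Δₑ c₀ (suc N + N) ≤ occ Δₑ c₀ (suc N) + n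
  c₀-scarce-from-middle = begin
    occ Δₑ c₀ (suc N + N)
      ≡⟨ sym (occ-from-middle c₀ N) ⟩
    occ Δₑ c₀ (suc N) + occ fromMiddle c₀ N
      ≡⟨ cong (λ k → occ Δₑ c₀ (suc N) + occ fromMiddle c₀ k) (sym 1+[N∸1]≡N) ⟩
    occ Δₑ c₀ (suc N) + occ fromMiddle c₀ (1 + (N ∸ 1))
      ≡⟨ cong (occ Δₑ c₀ (suc N) +_) (sym (count-+ (λ x → fromMiddle x == c₀) 1 (N ∸ 1))) ⟩
    occ Δₑ c₀ (suc N) + (indicator (c₀ == c₀) + occ secondBlock c₀ (N ∸ 1))
      ≡⟨ cong (λ b → occ Δₑ c₀ (suc N) + (indicator b + occ secondBlock c₀ (N ∸ 1))) (==-refl c₀) ⟩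
    occ Δₑ c₀ (suc N) + suc (occ secondBlock c₀ (N ∸ 1))
      ≤⟨ +-monoʳ-≤ (occ Δₑ c₀ (suc N)) (proj₂ scarce) ⟩
    occ Δₑ c₀ (suc N) + n ∎
    where open ≤-Reasoning

  window-dominated : ∀ t j c → suc j ≤ N → c ≤ n →
    occ Δₑ t (suc N) + c ≤ occ Δₑ t (suc N + suc j) → occ Δₑ t 1 + c ≤ occ Δₑ t (suc (suc j))
  window-dominated t j c 1+j≤N c≤n upper = begin
    occ Δₑ t 1 + c                             ≤⟨ +-monoʳ-≤ (occ Δₑ t 1) (⊓-glb c≤occ c≤n) ⟩
    occ Δₑ t 1 + occ fromMiddle t (suc j) ⊓ n  ≤⟨ +-monoʳ-≤ (occ Δₑ t 1) (balance-dominates t (suc j)) ⟩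
    occ Δₑ t 1 + occ balance t (suc j)         ≡⟨ occ-first t (suc j) 1+j≤N ⟩
    occ Δₑ t (suc (suc j))                     ∎
    where
    open ≤-Reasoning
    c≤occ : c ≤ occ fromMiddle t (suc j)
    c≤occ = +-cancelˡ-≤ (occ Δₑ t (suc N)) c _ (≤-trans upper (≤-reflexive (sym (occ-from-middle t (suc j)))))

  S-bounds : ∀ {x} → S x → 1 ≤ x × x ≤ N + N
  S-bounds (inj₁ (1≤x , x≤N+1)) = 1≤x , ≤-trans x≤N+1 (+-monoʳ-≤ N 1≤N)
  S-bounds {x} (inj₂ (N+2≤x , x≤2rn)) =
    ≤-trans (s≤s z≤n) (subst (_≤ x) N+2≡2+N N+2≤x) ,
    subst (x ≤_) (trans (*-assoc 2 r n) (cong (N +_) (+-identityʳ N))) x≤2rn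

  S-second-block : ∀ {x} → S x → suc (suc N) ≤ x → I₂ x
  S-second-block {x} (inj₁ (_ , x≤N+1)) N+2≤x =
    contradiction (≤-trans N+2≤x (subst (x ≤_) (+-comm N 1) x≤N+1)) 1+n≰n
  S-second-block (inj₂ x∈I₂) _ = x∈I₂

  within-second-block : ∀ (Z : MSet (suc n)) → Z ⊆ˢ S → Monochromatic Δₑ Z → suc (suc N) ≤ x₁ Z →
    Z ⊆ˢ I₂ × Monochromatic Δ Z
  within-second-block Z Z⊆S mono N+2≤z =
    (λ i → S-second-block (Z⊆S i) (high i)) ,
    (λ i j → trans (sym (Δₑ-second-block (high i))) (trans (mono i j) (Δₑ-second-block (high j))))
    where
    high : ∀ i → suc (suc N) ≤ elt Z i
    high i = ≤-trans N+2≤z (x₁≤elt Z i)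

  module _ (X : MSet (suc n)) (X⊆S : X ⊆ˢ S) (mono : Monochromatic Δₑ X) where

    private
      t : Fin r
      t = Δₑ (x₁ X)

      xₘ≤N+N : xₘ X ≤ N + N
      xₘ≤N+N = proj₂ (S-bounds (X⊆S (Fin.fromℕ n)))

    starts-at-middle : x₁ X ≡ suc N → ⊥
    starts-at-middle x₁≡1+N = 1+n≰n (+-cancelˡ-≤ (occ Δₑ c₀ (suc N)) _ _ (≤-trans counted c₀-scarce-from-middle))
      where
      counted : occ Δₑ c₀ (suc N) + suc n ≤ occ Δₑ c₀ (suc N + N)
      counted = subst (λ c → occ Δₑ c (suc N) + suc n ≤ occ Δₑ c (suc N + N)) (trans (cong Δₑ x₁≡1+N) Δₑ-middle)
        (occ-points Δₑ X mono 0 (suc n) (suc N) (suc N + N) (m≤m+n (suc N) N) ≤-refl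
          λ j _ j≤n → subst (_≤ point X j) x₁≡1+N (x₁≤point X j (≤-pred j≤n)) ,
                      s≤s (≤-trans (point≤xₘ X j (≤-pred j≤n)) xₘ≤N+N))

    crosses-middle : x₁ X ≤ N → xₘ X + xₘ X ≤ N + N + x₁ X →
      ∀ k → k ≤ n → (∀ j → j < k → point X j ≤ N) → N < point X k → ⊥
    crosses-middle x₁≤N spread k k≤n below exceeds =
      1+n≰n (+-cancelˡ-≤ (occ Δₑ t 1) _ _ (begin
        occ Δₑ t 1 + (suc l + k)     ≡⟨ sym (+-assoc (occ Δₑ t 1) (suc l) k) ⟩
        occ Δₑ t 1 + suc l + k       ≤⟨ +-monoˡ-≤ k (window-dominated t j (suc l) 1+j≤N 1+l≤n upper) ⟩
        occ Δₑ t (suc (suc j)) + k   ≤⟨ +-monoˡ-≤ k (count-mono _ 2+j≤x₁) ⟩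
        occ Δₑ t (x₁ X) + k          ≤⟨ lower ⟩
        occ Δₑ t (suc N)             ≡⟨ first-block-balanced t ⟩
        occ Δₑ t 1 + n               ≡⟨ cong (occ Δₑ t 1 +_) (trans (sym k+l≡n) (+-comm k l)) ⟩
        occ Δₑ t 1 + (l + k)         ∎))
      where
      open ≤-Reasoning
      l : ℕ
      l = n ∸ k
      k+l≡n : k + l ≡ n
      k+l≡n = m+[n∸m]≡n k≤n
      1≤k : 1 ≤ k
      1≤k = ≤∧≢⇒< z≤n λ 0≡k →
        <⇒≱ (subst (N <_) (point-first X) (subst (λ i → N < point X i) (sym 0≡k) exceeds)) x₁≤N
      1+l≤n : suc l ≤ n
      1+l≤n = ≤-trans (+-monoˡ-≤ l 1≤k) (≤-reflexive k+l≡n)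
      N<xₘ : N < xₘ X
      N<xₘ = <-≤-trans exceeds (point≤xₘ X k k≤n)
      j : ℕ
      j = xₘ X ∸ suc N
      1+N+j≡xₘ : suc N + j ≡ xₘ X
      1+N+j≡xₘ = m+[n∸m]≡n N<xₘ
      2+j≤x₁ : suc (suc j) ≤ x₁ X
      2+j≤x₁ = window-before-start N j (x₁ X) (subst (λ b → b + b ≤ N + N + x₁ X) (sym 1+N+j≡xₘ) spread)
      1+j≤N : suc j ≤ N
      1+j≤N = ≤-trans (n≤1+n (suc j)) (≤-trans 2+j≤x₁ x₁≤N)
      lower : occ Δₑ t (x₁ X) + k ≤ occ Δₑ t (suc N)
      lower = occ-points Δₑ X mono 0 k (x₁ X) (suc N) (m≤n⇒m≤1+n x₁≤N) (m≤n⇒m≤1+n k≤n)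
        λ i _ i<k → x₁≤point X i (≤-trans (<⇒≤ i<k) k≤n) , s≤s (below i i<k)
      k+1+l≡1+n : k + suc l ≡ suc n
      k+1+l≡1+n = trans (+-suc k l) (cong suc k+l≡n)
      upper : occ Δₑ t (suc N) + suc l ≤ occ Δₑ t (suc N + suc j)
      upper = occ-points Δₑ X mono k (suc l) (suc N) (suc N + suc j) (m≤m+n (suc N) (suc j)) (≤-reflexive k+1+l≡1+n)
        λ i k≤i i<k+1+l → let i≤n = ≤-pred (subst (i <_) k+1+l≡1+n i<k+1+l) in
          ≤-trans exceeds (point-≤ X k≤i i≤n) ,
          ≤-<-trans (point≤xₘ X i i≤n) (subst (_< suc N + suc j) 1+N+j≡xₘ (+-monoʳ-< (suc N) (n<1+n j)))

    starts-in-first-block : x₁ X ≤ N → xₘ X + xₘ X ≤ N + N + x₁ X → ⊥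
    starts-in-first-block x₁≤N spread with threshold (point X) N n
    ... | inj₂ (k , k≤n , below , exceeds) = crosses-middle x₁≤N spread k k≤n below exceeds
    ... | inj₁ all≤N = 1+n≰n (+-cancelˡ-≤ (occ Δₑ t 1) _ _ (begin
      occ Δₑ t 1 + suc n        ≤⟨ +-monoˡ-≤ (suc n) (count-mono _ (proj₁ (S-bounds (X⊆S Fin.zero)))) ⟩
      occ Δₑ t (x₁ X) + suc n   ≤⟨ counted ⟩
      occ Δₑ t (suc N)          ≡⟨ first-block-balanced t ⟩
      occ Δₑ t 1 + n            ∎))
      where
      open ≤-Reasoning
      counted : occ Δₑ t (x₁ X) + suc n ≤ occ Δₑ t (suc N)
      counted = occ-points Δₑ X mono 0 (suc n) (x₁ X) (suc N) (m≤n⇒m≤1+n x₁≤N) ≤-refl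
        λ j _ j≤n → x₁≤point X j (≤-pred j≤n) , s≤s (all≤N j (≤-pred j≤n))

  Δₑ-LColoring : LColoring (suc n) r I₂ Δ → LColoring (suc n) r S Δₑ
  Δₑ-LColoring Δ-L (X , Y , X⊆S , Y⊆S , monoX , monoY , X≺Y , gap) = by-start (<-cmp (x₁ X) (suc N))
    where
    spread : xₘ X + xₘ X ≤ N + N + x₁ X
    spread = ≤-trans (double-gap (x₁<xₘ X 1≤n) gap) (+-monoˡ-≤ (x₁ X) (proj₂ (S-bounds (Y⊆S (Fin.fromℕ n)))))
    by-start : Tri (x₁ X < suc N) (x₁ X ≡ suc N) (suc N < x₁ X) → ⊥
    by-start (tri< x₁≤N _ _) = starts-in-first-block X X⊆S monoX (≤-pred x₁≤N) spread
    by-start (tri≈ _ x₁≡1+N _) = starts-at-middle X X⊆S monoX x₁≡1+N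
    by-start (tri> _ _ N+1<x₁) =
      let (X⊆I₂ , monoΔX) = within-second-block X X⊆S monoX N+1<x₁
          (Y⊆I₂ , monoΔY) = within-second-block Y Y⊆S monoY
                              (≤-trans N+1<x₁ (<⇒≤ (<-trans (x₁<xₘ X 1≤n) X≺Y)))
      in Δ-L (X , Y , X⊆I₂ , Y⊆I₂ , monoΔX , monoΔY , X≺Y , gap)

  Δₑ-agrees : ∀ x → I₂ x → Δₑ x ≡ Δ x
  Δₑ-agrees x (N+2≤x , _) = Δₑ-second-block (subst (_≤ x) N+2≡2+N N+2≤x)

  Δₑ-ends : Δₑ 1 ≡ Δₑ (N + 1)
  Δₑ-ends = begin
    Δₑ 1         ≡⟨ Δₑ-first 1≤N ⟩
    balance 0    ≡⟨ balance-head 1≤n ⟩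
    c₀           ≡⟨ sym Δₑ-middle ⟩
    Δₑ (suc N)   ≡⟨ cong Δₑ (+-comm 1 N) ⟩
    Δₑ (N + 1)   ∎
    where open ≡-Reasoning

  countColor-Δₑ : ∀ t → countColor Δₑ t N ≡ n
  countColor-Δₑ t = begin
    countColor Δₑ t N                ≡⟨ length-filter-applyUpTo (λ x → Δₑ x Fin.≟ t) suc N ⟩
    count (λ i → Δₑ (suc i) == t) N  ≡⟨ count-cong N (λ i i<N → cong (_== t) (Δₑ-first i<N)) ⟩
    occ balance t N                  ≡⟨ balance-balanced t ⟩
    n                                ∎
    where open ≡-Reasoning

lemma2p2 : (m r : ℕ) .{{_ : NonZero m}} → 2 ≤ m → 1 ≤ r →
    (Δ : ℕ → Fin r) →
    LColoring m r [ r * (m ∸ 1) + 2 , 2 * r * (m ∸ 1) ] Δ →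
    Σ (ℕ → Fin r) λ Δₑ →
      LColoring m r ([ 1 , r * (m ∸ 1) + 1 ] ∪ [ r * (m ∸ 1) + 2 , 2 * r * (m ∸ 1) ]) Δₑ ×
      (∀ x → [ r * (m ∸ 1) + 2 , 2 * r * (m ∸ 1) ] x → Δₑ x ≡ Δ x) ×
      Δₑ 1 ≡ Δₑ (r * (m ∸ 1) + 1) ×
      (∀ (t : Fin r) → countColor Δₑ t (r * (m ∸ 1)) ≡ m ∸ 1)
lemma2p2 (suc (suc k)) r (s≤s (s≤s z≤n)) 1≤r Δ Δ-L =
  Δₑ , Δₑ-LColoring Δ-L , Δₑ-agrees , Δₑ-ends , countColor-Δₑ
  where open Extension 1≤r (s≤s z≤n) Δ
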